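{- Let $k$ be an odd positive integer. Then there exist infinitely many integers $r$ such that $\mathrm{bal}_r(n,P_{rk})=\Omega(n^2)$ (as $n\to\infty$). In particular, $\mathrm{bal}_7(n,P_{7k})=\Omega(n^2)$.
   Context: $P_m$ denotes the path with $m$ edges. An $r$-edge-colored graph $G$ is balanced if each of the $r$ colors appears on either $\lfloor e(G)/r\rfloor$ or $\lceil e(G)/r\rceil$ edges. For a graph $G$, $\mathrm{bal}_r(n,G)$ is the minimum integer $m$ (if it exists) such that every $r$-edge-coloring of $K_n$ with more than $m$ edges in each of the $r$ colors contains a balanced copy of $G$ (a subgraph isomorphic to $G$ whose inherited coloring is balanced); if no such $m$ exists, $\mathrm{bal}_r(n,G)=\infty$. -}

module Defs where

open import Data.Nat using (ℕ; zero; suc; _+_; _*_; _∸_; _≤_; _<_; NonZero)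
open import Data.Nat.DivMod using (_/_)
open import Data.Fin using (Fin; toℕ; inject₁) renaming (suc to fsuc; _≟_ to _≟ᶠ_; _<?_ to _<?ᶠ_)
open import Data.List using (List; length; filter; map; concatMap; allFin)
open import Data.Product using (_×_; _,_; proj₁; proj₂; Σ; ∃)
open import Function.Definitions using (Injective)
open import Relation.Binary.PropositionalEquality using (_≡_)

-- An r-edge-colouring of K_n: a symmetric colour function on pairs of
-- vertices (only its values on pairs of distinct vertices matter).
record Colouring (n r : ℕ) : Set where
  field
    col  : Fin n → Fin n → Fin r
    symm : ∀ i j → col i j ≡ col j i
open Colouring public

edgesK : (n : ℕ) → List (Fin n × Fin n)
edgesK n = concatMap (λ i → map (λ j → (i , j)) (filter (λ j → i <?ᶠ j) (allFin n))) (allFin n)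

colourCount : ∀ {n r} → Colouring n r → Fin r → ℕ
colourCount {n} c x = length (filter (λ e → col c (proj₁ e) (proj₂ e) ≟ᶠ x) (edgesK n))

⌈_/_⌉ : (m r : ℕ) .{{_ : NonZero r}} → ℕ
⌈ m / r ⌉ = (m + (r ∸ 1)) / r

-- A copy of the path P_m (m edges) in K_n: m+1 distinct vertices v_0,...,v_m.
record PathCopy (n m : ℕ) : Set where
  field
    vert : Fin (suc m) → Fin n
    inj  : Injective _≡_ _≡_ vert
open PathCopy public

pathEdgeColour : ∀ {n r m} → Colouring n r → PathCopy n m → Fin m → Fin r
pathEdgeColour c p i = col c (vert p (inject₁ i)) (vert p (fsuc i))

pathColourCount : ∀ {n r m} → Colouring n r → PathCopy n m → Fin r → ℕ
pathColourCount {m = m} c p x = length (filter (λ i → pathEdgeColour c p i ≟ᶠ x) (allFin m))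

-- Balanced: every colour appears on ⌊m/r⌋ or ⌈m/r⌉ edges (equivalently,
-- between these two values, as they differ by at most one).
BalancedPath : ∀ {n r m} .{{_ : NonZero r}} → Colouring n r → PathCopy n m → Set
BalancedPath {r = r} {m = m} c p =
  ∀ (x : Fin r) → (m / r ≤ pathColourCount c p x) × (pathColourCount c p x ≤ ⌈ m / r ⌉)

-- m is admissible in the definition of bal_r(n, P_len): every r-colouring of
-- K_n with more than m edges of each colour contains a balanced copy of P_len.
BalAdmissible : (r n len m : ℕ) .{{_ : NonZero r}} → Set
BalAdmissible r n len m =
  ∀ (c : Colouring n r) → (∀ x → m < colourCount c x) →
  Σ (PathCopy n len) (λ p → BalancedPath c p)

-- bal_r(n, P_len) is the minimum admissible m (∞ if none).
-- bal_r(n, P_len) = Ω(n²): there are a constant c = a/(b+1) > 0 and n₀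
-- such that for all n ≥ n₀, bal_r(n, P_len) ≥ c·n², i.e. every admissible m
-- (hence the minimum one, if any) satisfies (b+1)·m ≥ a·n².
BalOmegaSq : (r len : ℕ) .{{_ : NonZero r}} → Set
BalOmegaSq r len =
  Σ ℕ λ a → Σ ℕ λ b → Σ ℕ λ n₀ → (0 < a) ×
    (∀ n → n₀ ≤ n → ∀ m → BalAdmissible r n len m → a * (n * n) ≤ suc b * m)

-- Let r = 7 + s and sort the vertices of K_n by their residue modulo 4 + s.  Residues
-- 0, 1, 2 form parts V₀, V₁, V₂; the remaining s + 1 residues form V₃.  The six colours
-- 0–5 go to the edges between distinct parts, one colour per edge of K₄; an edge inside
-- the residue class 3 + t gets colour 6 + t, and every other edge colour 6.  Each colour
-- class contains a complete bipartite graph between two residue classes, hence about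
-- (n / 2(4 + s))² edges.  A balanced copy of P_{rk} would have exactly k edges of every
-- colour.  The edges leaving V_j (j = 0, 1, 2) are exactly those carrying the three
-- K₄-colours at j, so the path crosses the cut around V_j 3k times, an odd number, and
-- its endpoints are separated by all three cuts, although two vertices meet at most
-- two of V₀, V₁, V₂.

module Submission where

open import Defs
open import Data.Nat using (ℕ; zero; suc; _+_; _*_; _≤_; _<_; NonZero; z≤n; s≤s; parity)
open import Data.Nat.Properties hiding (_≟_)
open import Data.Nat.Properties using () renaming (_≟_ to _≟ℕ_)
open import Data.Nat.DivMod using (_/_; _%_; _mod_; m*n/n≡m; m/n*n≤m; m≥n⇒m/n>0; m<n*o⇒m/o<n;
  m%n<n; m≡m%n+[m/n]*n; [m+kn]%n≡m%n; m<n⇒m%n≡m)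
open import Data.Parity.Base as ℙ using (0ℙ; 1ℙ)
open import Data.Parity.Properties using (+-homo-+; *-homo-*; p≢p⁻¹)
open import Data.Bool using (Bool; true; false; _xor_)
open import Data.Bool.Properties using (xor-same; not-¬) renaming (_≟_ to _≟ᴮ_)
open import Data.Maybe using (Maybe; just; nothing; maybe′)
open import Data.Maybe.Properties using () renaming (≡-dec to ≡-decᴹ)
open import Data.Fin as Fin using (Fin; zero; suc; toℕ; fromℕ; fromℕ<; inject₁; punchIn; _↑ˡ_; _↑ʳ_)
  renaming (_<?_ to _<?ᶠ_)
open import Data.Fin.Patterns using (0F; 1F; 2F; 3F; 4F; 5F)
open import Data.Fin.Properties using (_≟_; all?; any?; toℕ<n; toℕ-fromℕ<; toℕ-injective; injective⇒≤; *↔×)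
open import Data.List using (List; length; filter; tabulate; lookup)
open import Data.List.Membership.Propositional using (_∈_)
open import Data.List.Membership.Propositional.Properties using (∈-filter⁺; ∈-map⁺; ∈-concatMap⁺; ∈-allFin)
open import Data.List.Relation.Unary.Any as Any using ()
open import Data.List.Relation.Unary.Any.Properties using (lookup-index)
open import Data.Product using (Σ; ∃; ∃₂; _×_; _,_; proj₁; proj₂)
open import Data.Product.Properties using (,-injectiveˡ; ,-injectiveʳ)
open import Function using (_∘_; id; Injective; _↣_; Injection)
open import Function.Properties.Inverse using (↔⇒↣)
open import Relation.Nullary using (¬_; does; yes; no; contradiction)
open import Relation.Nullary.Decidable using (toWitness)
open import Relation.Unary using (Pred; Decidable)
open import Relation.Binary.PropositionalEquality
open import Algebra.Properties.CommutativeSemigroup *-commutativeSemigroup using (interchange)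
open import Algebra.Properties.CommutativeMonoid.Sum +-0-commutativeMonoid using (sum-syntax; ∑-comm; sum-cong-≗)

indicator : Bool → ℕ
indicator true  = 1
indicator false = 0

length-filter-tabulate : ∀ {a p} {A : Set a} {P : Pred A p} (P? : Decidable P) {n} (f : Fin n → A) →
  length (filter P? (tabulate f)) ≡ ∑[ i < n ] indicator (does (P? (f i)))
length-filter-tabulate P? {zero}  f = refl
length-filter-tabulate P? {suc n} f with does (P? (f zero))
... | true  = cong suc (length-filter-tabulate P? (f ∘ suc))
... | false = length-filter-tabulate P? (f ∘ suc)

pathColourCount≡∑ : ∀ {n r m} (c : Colouring n r) (p : PathCopy n m) x →
  pathColourCount c p x ≡ ∑[ i < m ] indicator (does (pathEdgeColour c p i ≟ x))
pathColourCount≡∑ c p x = length-filter-tabulate (λ i → pathEdgeColour c p i ≟ x) id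

crossings : ∀ {m} → (Fin (suc m) → Bool) → ℕ
crossings {m} b = ∑[ i < m ] indicator (b (inject₁ i) xor b (suc i))

parity-indicator-xor-trans : ∀ x y z →
  parity (indicator (x xor y)) ℙ.+ parity (indicator (y xor z)) ≡ parity (indicator (x xor z))
parity-indicator-xor-trans true  true  z     = refl
parity-indicator-xor-trans true  false true  = refl
parity-indicator-xor-trans true  false false = refl
parity-indicator-xor-trans false true  true  = refl
parity-indicator-xor-trans false true  false = refl
parity-indicator-xor-trans false false z     = refl

parity-crossings : ∀ {m} (b : Fin (suc m) → Bool) →
  parity (crossings b) ≡ parity (indicator (b zero xor b (fromℕ m)))
parity-crossings {zero}  b = cong (parity ∘ indicator) (sym (xor-same (b zero)))
parity-crossings {suc m} b = begin
  parity (indicator (b 0F xor b 1F) + crossings (b ∘ suc))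
    ≡⟨ +-homo-+ (indicator (b 0F xor b 1F)) (crossings (b ∘ suc)) ⟩
  parity (indicator (b 0F xor b 1F)) ℙ.+ parity (crossings (b ∘ suc))
    ≡⟨ cong (parity (indicator (b 0F xor b 1F)) ℙ.+_) (parity-crossings (b ∘ suc)) ⟩
  parity (indicator (b 0F xor b 1F)) ℙ.+ parity (indicator (b 1F xor b (fromℕ (suc m))))
    ≡⟨ parity-indicator-xor-trans (b 0F) (b 1F) (b (fromℕ (suc m))) ⟩
  parity (indicator (b 0F xor b (fromℕ (suc m)))) ∎
  where open ≡-Reasoning

odd-crossings⇒endpoints-separated : ∀ {m} (b : Fin (suc m) → Bool) →
  parity (crossings b) ≡ 1ℙ → b zero xor b (fromℕ m) ≡ true
odd-crossings⇒endpoints-separated {m} b odd with b zero xor b (fromℕ m) | parity-crossings b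
... | true  | _  = refl
... | false | eq = contradiction (trans (sym odd) eq) (p≢p⁻¹ 1ℙ)

parity[2j+1]≡1ℙ : ∀ j → parity (2 * j + 1) ≡ 1ℙ
parity[2j+1]≡1ℙ j = begin
  parity (2 * j + 1)             ≡⟨ +-homo-+ (2 * j) 1 ⟩
  parity (2 * j) ℙ.+ 1ℙ          ≡⟨ cong (ℙ._+ 1ℙ) (*-homo-* 2 j) ⟩
  0ℙ ℙ.* parity j ℙ.+ 1ℙ         ≡⟨⟩
  1ℙ                             ∎
  where open ≡-Reasoning

⌈n*m/n⌉≤m : ∀ n m .{{_ : NonZero n}} → ⌈ n * m / n ⌉ ≤ m
⌈n*m/n⌉≤m n@(suc n-1) m = m<1+n⇒m≤n (m<n*o⇒m/o<n (begin-strict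
  n * m + n-1  <⟨ +-monoʳ-< (n * m) (n<1+n n-1) ⟩
  n * m + n    ≡⟨ +-comm (n * m) n ⟩
  n + n * m    ≡⟨ cong (n +_) (*-comm n m) ⟩
  suc m * n    ∎))
  where open ≤-Reasoning

balanced⇒pathColourCount≡ : ∀ {n r k} .{{_ : NonZero r}} (c : Colouring n r) (p : PathCopy n (r * k)) →
  BalancedPath c p → ∀ x → pathColourCount c p x ≡ k
balanced⇒pathColourCount≡ {r = r} {k} c p balanced x = ≤-antisym
  (≤-trans (proj₂ (balanced x)) (⌈n*m/n⌉≤m r k))
  (subst (_≤ pathColourCount c p x) r*k/r≡k (proj₁ (balanced x)))
  where r*k/r≡k : r * k / r ≡ k
        r*k/r≡k = trans (cong (_/ r) (*-comm r k)) (m*n/n≡m k r)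

injection⇒≤length : ∀ {a} {A : Set a} {N} {xs : List A} (f : Fin N → A) →
  Injective _≡_ _≡_ f → (∀ z → f z ∈ xs) → N ≤ length xs
injection⇒≤length {xs = xs} f f-inj f∈xs = injective⇒≤ {f = Any.index ∘ f∈xs} λ {z} {z′} eq →
  f-inj (trans (lookup-index (f∈xs z)) (trans (cong (lookup xs) eq) (sym (lookup-index (f∈xs z′)))))

∈-edgesK : ∀ {n} {i j : Fin n} → i Fin.< j → (i , j) ∈ edgesK n
∈-edgesK {n} {i} {j} i<j = ∈-concatMap⁺ _
  (Any.map (λ { refl → ∈-map⁺ (i ,_) (∈-filter⁺ (i <?ᶠ_) (∈-allFin j) i<j) }) (∈-allFin i))

biclique⇒colourCount : ∀ {n r K} (c : Colouring n r) {x} (f g : Fin K → Fin n) →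
  Injective _≡_ _≡_ f → Injective _≡_ _≡_ g → (∀ u v → f u Fin.< g v) →
  (∀ u v → col c (f u) (g v) ≡ x) → K * K ≤ colourCount c x
biclique⇒colourCount {K = K} c {x} f g f-inj g-inj f<g monochromatic =
  injection⇒≤length edge edge-injective edge∈colourClass
  where
  pairs : Fin (K * K) ↣ (Fin K × Fin K)
  pairs = ↔⇒↣ (*↔× {K} {K})
  edge : Fin (K * K) → Fin _ × Fin _
  edge z = f (proj₁ (Injection.to pairs z)) , g (proj₂ (Injection.to pairs z))
  edge-injective : Injective _≡_ _≡_ edge
  edge-injective eq = Injection.injective pairs
    (cong₂ _,_ (f-inj (,-injectiveˡ eq)) (g-inj (,-injectiveʳ eq)))
  edge∈colourClass : ∀ z → edge z ∈ filter (λ e → col c (proj₁ e) (proj₂ e) ≟ x) (edgesK _)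
  edge∈colourClass z = ∈-filter⁺ (λ e → col c (proj₁ e) (proj₂ e) ≟ x)
    (∈-edgesK (f<g u v)) (monochromatic u v)
    where u = proj₁ (Injection.to pairs z)
          v = proj₂ (Injection.to pairs z)

n≤[d+d]*[n/d] : ∀ n d .{{_ : NonZero d}} → d ≤ n → n ≤ (d + d) * (n / d)
n≤[d+d]*[n/d] n d d≤n = begin
  n               ≡⟨ m≡m%n+[m/n]*n n d ⟩
  n % d + K * d   ≤⟨ +-monoˡ-≤ (K * d) (<⇒≤ (m%n<n n d)) ⟩
  d + K * d       ≤⟨ +-monoˡ-≤ (K * d) d≤K*d ⟩
  K * d + K * d   ≡⟨ cong₂ _+_ (*-comm K d) (*-comm K d) ⟩
  d * K + d * K   ≡⟨ *-distribʳ-+ K d d ⟨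
  (d + d) * K     ∎
  where
  open ≤-Reasoning
  K = n / d
  d≤K*d : d ≤ K * d
  d≤K*d = subst (_≤ K * d) (*-identityˡ d) (*-monoˡ-≤ d (m≥n⇒m/n>0 d≤n))

n*n≤[d+d]²*[n/d]² : ∀ n d .{{_ : NonZero d}} → d ≤ n →
  n * n ≤ (d + d) * (d + d) * ((n / d) * (n / d))
n*n≤[d+d]²*[n/d]² n d d≤n = begin
  n * n                                   ≤⟨ *-mono-≤ n≤ n≤ ⟩
  (d + d) * (n / d) * ((d + d) * (n / d))   ≡⟨ interchange (d + d) (n / d) (d + d) (n / d) ⟩
  (d + d) * (d + d) * ((n / d) * (n / d))   ∎
  where
  open ≤-Reasoning
  n≤ = n≤[d+d]*[n/d] n d d≤n

balOmegaSq-from-colourings : ∀ r len d .{{_ : NonZero r}} .{{_ : NonZero d}} →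
  (∀ n → d ≤ n → Σ (Colouring n r) λ c →
     (∀ x → (n / d) * (n / d) ≤ colourCount c x) × (∀ (p : PathCopy n len) → ¬ BalancedPath c p)) →
  BalOmegaSq r len
balOmegaSq-from-colourings r len d colourings = 1 , E , d , s≤s z≤n , bound
  where
  E = (d + d) * (d + d)
  bound : ∀ n → d ≤ n → ∀ m → BalAdmissible r n len m → 1 * (n * n) ≤ suc E * m
  bound n d≤n m admissible with colourings n d≤n
  ... | c , dense , unbalanced = begin
    1 * (n * n)  ≡⟨ *-identityˡ (n * n) ⟩
    n * n        ≤⟨ n*n≤[d+d]²*[n/d]² n d d≤n ⟩
    E * (K * K)  ≤⟨ *-monoʳ-≤ E K*K≤m ⟩
    E * m        ≤⟨ m≤n+m (E * m) m ⟩
    suc E * m    ∎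
    where
    open ≤-Reasoning
    K = n / d
    K*K≤m : K * K ≤ m
    K*K≤m = ≮⇒≥ λ m<K*K →
      let (p , balanced) = admissible c (λ x → <-≤-trans m<K*K (dense x)) in unbalanced p balanced

k4Edge : Fin 4 → Fin 4 → Maybe (Fin 6)
k4Edge 0F 1F = just 0F
k4Edge 0F 2F = just 1F
k4Edge 1F 2F = just 2F
k4Edge 0F 3F = just 3F
k4Edge 1F 3F = just 4F
k4Edge 2F 3F = just 5F
k4Edge 1F 0F = just 0F
k4Edge 2F 0F = just 1F
k4Edge 2F 1F = just 2F
k4Edge 3F 0F = just 3F
k4Edge 3F 1F = just 4F
k4Edge 3F 2F = just 5F
k4Edge _  _  = nothing

k4Edge-sym : ∀ u v → k4Edge u v ≡ k4Edge v u
k4Edge-sym = toWitness {a? = all? λ u → all? λ v → ≡-decᴹ _≟_ (k4Edge u v) (k4Edge v u)} _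

isPart : Fin 3 → Fin 4 → Bool
isPart j u = does (inject₁ j ≟ u)

two-parts-avoid-some-special-part : ∀ u v → ∃ λ j → isPart j u xor isPart j v ≡ false
two-parts-avoid-some-special-part =
  toWitness {a? = all? λ u → all? λ v → any? λ j → (isPart j u xor isPart j v) ≟ᴮ false} _

module Construction (s : ℕ) where

  q : ℕ
  q = 4 + s

  colourOf : Fin 4 → Fin 4 → Fin (suc s) → Fin (7 + s)
  colourOf u v t = maybe′ (_↑ˡ suc s) (6 ↑ʳ t) (k4Edge u v)

  cutColour : Fin 3 → Fin 3 → Fin (7 + s)
  cutColour j w = colourOf (inject₁ j) (punchIn (inject₁ j) w) 0F

  -- A finite check even though t is a variable: t only matters on the diagonal, where
  -- colourOf is never a cut colour.
  crossing-colours : ∀ t u v j →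
    indicator (isPart j u xor isPart j v) ≡ ∑[ w < 3 ] indicator (does (colourOf u v t ≟ cutColour j w))
  crossing-colours t = toWitness {a? = all? λ u → all? λ v → all? λ j →
    indicator (isPart j u xor isPart j v) ≟ℕ ∑[ w < 3 ] indicator (does (colourOf u v t ≟ cutColour j w))} _

  part : Fin q → Fin 4
  part 0F                  = 0F
  part 1F                  = 1F
  part 2F                  = 2F
  part (suc (suc (suc _))) = 3F

  subpart : Fin q → Fin (suc s)
  subpart (suc (suc (suc t))) = t
  subpart _                   = 0F

  innerColour : Fin q → Fin q → Fin (suc s)
  innerColour a b with a ≟ b
  ... | yes _ = subpart a
  ... | no  _ = 0F

  innerColour-sym : ∀ a b → innerColour a b ≡ innerColour b a
  innerColour-sym a b with a ≟ b | b ≟ a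
  ... | yes refl | yes _    = refl
  ... | yes refl | no  a≢a  = contradiction refl a≢a
  ... | no  a≢b  | yes refl = contradiction refl a≢b
  ... | no  _    | no  _    = refl

  innerColour-diag : ∀ a → innerColour a a ≡ subpart a
  innerColour-diag a with a ≟ a
  ... | yes _   = refl
  ... | no  a≢a = contradiction refl a≢a

  edgeColour : Fin q → Fin q → Fin (7 + s)
  edgeColour a b = colourOf (part a) (part b) (innerColour a b)

  edgeColour-sym : ∀ a b → edgeColour a b ≡ edgeColour b a
  edgeColour-sym a b =
    cong₂ (maybe′ (_↑ˡ suc s) ∘ (6 ↑ʳ_)) (innerColour-sym a b) (k4Edge-sym (part a) (part b))

  edgeColour-surjective : ∀ x → ∃₂ λ a b → edgeColour a b ≡ x
  edgeColour-surjective 0F = 0F , 1F , refl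
  edgeColour-surjective 1F = 0F , 2F , refl
  edgeColour-surjective 2F = 1F , 2F , refl
  edgeColour-surjective 3F = 0F , 3F , refl
  edgeColour-surjective 4F = 1F , 3F , refl
  edgeColour-surjective 5F = 2F , 3F , refl
  edgeColour-surjective (suc (suc (suc (suc (suc (suc t)))))) =
    a , a , cong (6 ↑ʳ_) (innerColour-diag a)
    where a = suc (suc (suc t))

  label : ∀ {n} → Fin n → Fin q
  label i = toℕ i mod q

  colouring : ∀ n → Colouring n (7 + s)
  colouring n = record
    { col  = λ i j → edgeColour (label i) (label j)
    ; symm = λ i j → edgeColour-sym (label i) (label j)
    }

  blockVertex : ∀ {n} (a : Fin q) (t : ℕ) → suc t * q ≤ n → Fin n
  blockVertex a t fits = fromℕ< (<-≤-trans (+-monoˡ-< (t * q) (toℕ<n a)) fits)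

  toℕ-blockVertex : ∀ {n} a t (fits : suc t * q ≤ n) → toℕ (blockVertex a t fits) ≡ toℕ a + t * q
  toℕ-blockVertex a t fits = toℕ-fromℕ< _

  label-blockVertex : ∀ {n} a t (fits : suc t * q ≤ n) → label (blockVertex a t fits) ≡ a
  label-blockVertex a t fits = toℕ-injective (begin
    toℕ (toℕ (blockVertex a t fits) mod q)  ≡⟨ toℕ-fromℕ< _ ⟩
    toℕ (blockVertex a t fits) % q          ≡⟨ cong (_% q) (toℕ-blockVertex a t fits) ⟩
    (toℕ a + t * q) % q                         ≡⟨ [m+kn]%n≡m%n (toℕ a) t q ⟩
    toℕ a % q                                   ≡⟨ m<n⇒m%n≡m (toℕ<n a) ⟩
    toℕ a                                       ∎)
    where open ≡-Reasoning

  blockVertex-injective : ∀ {n} a t t′ (fits : suc t * q ≤ n) (fits′ : suc t′ * q ≤ n) →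
    blockVertex a t fits ≡ blockVertex a t′ fits′ → t ≡ t′
  blockVertex-injective a t t′ fits fits′ eq = *-cancelʳ-≡ t t′ q (+-cancelˡ-≡ (toℕ a) _ _
    (trans (sym (toℕ-blockVertex a t fits)) (trans (cong toℕ eq) (toℕ-blockVertex a t′ fits′))))

  blockVertex-monotone : ∀ {n} a b t t′ (fits : suc t * q ≤ n) (fits′ : suc t′ * q ≤ n) →
    t < t′ → blockVertex a t fits Fin.< blockVertex b t′ fits′
  blockVertex-monotone a b t t′ fits fits′ t<t′ = begin-strict
    toℕ (blockVertex a t fits)    ≡⟨ toℕ-blockVertex a t fits ⟩
    toℕ a + t * q                     <⟨ +-monoˡ-< (t * q) (toℕ<n a) ⟩
    suc t * q                         ≤⟨ *-monoˡ-≤ q t<t′ ⟩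
    t′ * q                            ≤⟨ m≤n+m (t′ * q) (toℕ b) ⟩
    toℕ b + t′ * q                    ≡⟨ toℕ-blockVertex b t′ fits′ ⟨
    toℕ (blockVertex b t′ fits′)  ∎
    where open ≤-Reasoning

  colourCount-dense : ∀ n x → (n / (q + q)) * (n / (q + q)) ≤ colourCount (colouring n) x
  colourCount-dense n x with edgeColour-surjective x
  ... | a , b , refl = biclique⇒colourCount (colouring n) left right
    (λ {u} {u′} eq → toℕ-injective (blockVertex-injective a _ _ (leftBlock u) (leftBlock u′) eq))
    (λ {v} {v′} eq → toℕ-injective (+-cancelˡ-≡ K _ _
      (blockVertex-injective b _ _ (rightBlock v) (rightBlock v′) eq)))
    (λ u v → blockVertex-monotone a b _ _ (leftBlock u) (rightBlock v)
      (<-≤-trans (toℕ<n u) (m≤m+n K (toℕ v))))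
    (λ u v → cong₂ edgeColour
      (label-blockVertex a (toℕ u) (leftBlock u)) (label-blockVertex b (K + toℕ v) (rightBlock v)))
    where
    K = n / (q + q)
    K+K-blocks : (K + K) * q ≤ n
    K+K-blocks = subst (_≤ n) (trans (*-distribˡ-+ K q q) (sym (*-distribʳ-+ q K K))) (m/n*n≤m n (q + q))
    inBlocks : ∀ {t} → t < K + K → suc t * q ≤ n
    inBlocks t<K+K = ≤-trans (*-monoˡ-≤ q t<K+K) K+K-blocks
    leftBlock : (u : Fin K) → suc (toℕ u) * q ≤ n
    leftBlock u = inBlocks (<-≤-trans (toℕ<n u) (m≤m+n K K))
    rightBlock : (v : Fin K) → suc (K + toℕ v) * q ≤ n
    rightBlock v = inBlocks (+-monoʳ-< K (toℕ<n v))
    left right : Fin K → Fin n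
    left u = blockVertex a (toℕ u) (leftBlock u)
    right v = blockVertex b (K + toℕ v) (rightBlock v)

  side : ∀ {n m} → PathCopy n m → Fin 3 → Fin (suc m) → Bool
  side p j i = isPart j (part (label (vert p i)))

  crossings≡∑cutColourCounts : ∀ {n m} (p : PathCopy n m) j →
    crossings (side p j) ≡ ∑[ w < 3 ] pathColourCount (colouring n) p (cutColour j w)
  crossings≡∑cutColourCounts {n} {m} p j = begin
    crossings (side p j)
      ≡⟨ sum-cong-≗ (λ i → crossing-colours (innerColour (a i) (b i)) (part (a i)) (part (b i)) j) ⟩
    ∑[ i < m ] ∑[ w < 3 ] indicator (does (pathEdgeColour (colouring n) p i ≟ cutColour j w))
      ≡⟨ ∑-comm (λ i w → indicator (does (pathEdgeColour (colouring n) p i ≟ cutColour j w))) ⟩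
    ∑[ w < 3 ] ∑[ i < m ] indicator (does (pathEdgeColour (colouring n) p i ≟ cutColour j w))
      ≡⟨ sum-cong-≗ (λ w → pathColourCount≡∑ (colouring n) p (cutColour j w)) ⟨
    ∑[ w < 3 ] pathColourCount (colouring n) p (cutColour j w) ∎
    where
    open ≡-Reasoning
    a b : Fin m → Fin q
    a i = label (vert p (inject₁ i))
    b i = label (vert p (suc i))

  no-balanced-path : ∀ {n} k → parity k ≡ 1ℙ → (p : PathCopy n ((7 + s) * k)) →
    ¬ BalancedPath (colouring n) p
  no-balanced-path {n} k k-odd p balanced
    with two-parts-avoid-some-special-part (part (label (vert p 0F))) (part (label (vert p (fromℕ _))))
  ... | j , not-separated = not-¬ separated not-separated
    where
    separated : side p j 0F xor side p j (fromℕ ((7 + s) * k)) ≡ true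
    separated = odd-crossings⇒endpoints-separated (side p j) (begin
      parity (crossings (side p j))  ≡⟨ cong parity (crossings≡∑cutColourCounts p j) ⟩
      parity (∑[ w < 3 ] pathColourCount (colouring n) p (cutColour j w))
        ≡⟨ cong parity (sum-cong-≗ (λ w →
             balanced⇒pathColourCount≡ {k = k} (colouring n) p balanced (cutColour j w))) ⟩
      parity (3 * k)                 ≡⟨ *-homo-* 3 k ⟩
      parity k                       ≡⟨ k-odd ⟩
      1ℙ                             ∎)
      where open ≡-Reasoning

  balOmegaSq : ∀ k → parity k ≡ 1ℙ → BalOmegaSq (7 + s) ((7 + s) * k)
  balOmegaSq k k-odd = balOmegaSq-from-colourings (7 + s) _ (q + q)
    (λ n _ → colouring n , colourCount-dense n , no-balanced-path k k-odd)

theorem1p8 : (k : ℕ) → (Σ ℕ λ j → k ≡ 2 * j + 1) →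
    (∀ (R : ℕ) → Σ ℕ λ r → Σ (NonZero r) λ nz → (R ≤ r) × BalOmegaSq r (r * k) {{nz}})
    × BalOmegaSq 7 (7 * k)
theorem1p8 k (j , k≡2j+1) = (λ R → 7 + R , _ , m≤n+m R 7 , balOmegaSq R) , balOmegaSq 0
  where
  k-odd : parity k ≡ 1ℙ
  k-odd = trans (cong parity k≡2j+1) (parity[2j+1]≡1ℙ j)
  balOmegaSq : ∀ s → BalOmegaSq (7 + s) ((7 + s) * k)
  balOmegaSq s = Construction.balOmegaSq s k k-odd
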